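{- Let $S$ be as in the context and suppose that $|\Pi_1|$ is even. For $u\in F_2^n$ let $k=|\Pi_1\cap\Delta(u)|$. (i) For $u\in U$: $$\mathbf{s_n}u=\begin{cases}u, & \text{if } k \text{ is even};\\ u+\sum_{\overline i\in\Pi_0}\overline i, & \text{otherwise},\end{cases}$$ and $$sw(\mathbf{s_n}u)=\begin{cases}sw(u), & \text{if } k \text{ is even};\\ n-|\Pi_1|+2k-sw(u), & \text{if } k \text{ is odd and } \overline n\in\Pi_1;\\ sw(u)+|\Pi_1|-2k, & \text{otherwise}.\end{cases}$$ (ii) For $u\in\overline U$: $$\mathbf{s_n}u=\begin{cases}u, & \text{if } k \text{ is odd};\\ u+\sum_{\overline i\in\Pi_0}\overline i, & \text{otherwise},\end{cases}$$ and $$sw(\mathbf{s_n}u)=\begin{cases}sw(u), & \text{if } k \text{ is odd};\\ n-|\Pi_1|+2k+2-sw(u), & \text{if } k \text{ is even and } \overline n\in\Pi_1;\\ sw(u)+|\Pi_1|-2k, & \text{otherwise}.\end{cases}$$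
   Context: $S$ is a finite simple connected graph with vertex set $\{s_1,\dots,s_n\}$, $n\ge2$, and edge set $R$, such that $s_1,\dots,s_{n-1}$ is an induced path; $s_n$ is adjacent to some of $s_1,\dots,s_{n-1}$. $\widetilde s$ is the characteristic vector in $F_2^n$ (coordinates indexed by vertices) of vertex $s$. The flipping move of $s$ is $\mathbf s\in\mathrm{Mat}_n(F_2)$ with $\mathbf s_{ab}=1$ if $a=b$, or if $b=s$ and $ab\in R$, and $0$ otherwise. $\overline1=\widetilde s_1$ and $\overline{i+1}=\mathbf{s_i}\cdots\mathbf{s_1}\overline1$ for $1\le i\le n-1$; also $\overline{n+1}:=\widetilde s_n$. $\Pi=\{\overline1,\dots,\overline n\}$, $\Pi_0=\{\overline i\in\Pi:\langle\overline i,\widetilde s_n\rangle=0\}$ (dot product over $F_2$), and $\Pi_1=\Pi\setminus\Pi_0$. $U=\mathrm{span}(\Pi)$ and $\overline U=F_2^n\setminus U$. When $|\Pi_1|$ is even, $\Delta=(\Pi\cup\{\overline{n+1}\})\setminus\{\overline n\}$, which is a basis of $F_2^n$. $\Delta(u)$ is the subset of $\Delta$ with $u=\sum_{x\in\Delta(u)}x$, and $sw(u)=|\Delta(u)|$. -}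

module Defs where

open import Data.Bool using (Bool; true; false; _∧_; _∨_; _xor_; not; if_then_else_)
open import Data.Nat using (ℕ; zero; suc; _<?_; _%_)
open import Data.Fin using (Fin; zero; suc; toℕ; inject₁; fromℕ; _≟_)
open import Data.List using (List; foldl; filter; allFin)
open import Data.Product using (Σ; _×_)
open import Data.Sum using (_⊎_)
open import Relation.Nullary.Decidable using (⌊_⌋)
open import Relation.Binary.PropositionalEquality using (_≡_)

-- Vectors of F₂ⁿ, coordinates indexed by vertices (vertex sᵢ ↔ index i-1).
F2^ : ℕ → Set
F2^ n = Fin n → Bool

_≈_ : ∀ {n} → F2^ n → F2^ n → Set
u ≈ v = ∀ a → u a ≡ v a
infix 4 _≈_

_⊕_ : ∀ {n} → F2^ n → F2^ n → F2^ n
(u ⊕ v) a = u a xor v a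
infixl 6 _⊕_

xorSum : ∀ {k} → (Fin k → Bool) → Bool
xorSum {zero} f = false
xorSum {suc k} f = f zero xor xorSum (λ i → f (suc i))

count : ∀ {k} → (Fin k → Bool) → ℕ
count {zero} f = 0
count {suc k} f = (if f zero then 1 else 0) Data.Nat.+ count (λ i → f (suc i))

sumOver : ∀ {k n} → (Fin k → Bool) → (Fin k → F2^ n) → F2^ n
sumOver E x a = xorSum (λ i → E i ∧ x i a)

chr : ∀ {n} → Fin n → F2^ n
chr s a = ⌊ a ≟ s ⌋

dot : ∀ {n} → F2^ n → F2^ n → Bool
dot u v = xorSum (λ a → u a ∧ v a)

Mat : ℕ → Set
Mat n = Fin n → Fin n → Bool

_·_ : ∀ {n} → Mat n → F2^ n → F2^ n
(M · v) a = xorSum (λ b → M a b ∧ v b)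
infixr 7 _·_

Adj : ℕ → Set
Adj n = Fin n → Fin n → Bool

flipMat : ∀ {n} → Adj n → Fin n → Mat n
flipMat adj s a b = ⌊ a ≟ b ⌋ ∨ (⌊ b ≟ s ⌋ ∧ adj a b)

data Walk {n} (adj : Adj n) : Fin n → Fin n → Set where
  here : ∀ {a} → Walk adj a a
  step : ∀ {a b c} → adj a b ≡ true → Walk adj b c → Walk adj a c

-- The graph S on n = m + 2 vertices s₁,…,sₙ (index i-1 for sᵢ):
-- simple (symmetric, irreflexive), connected, and s₁,…,sₙ₋₁ (indices inject₁ i,
-- i : Fin (m+1)) form an induced path; sₙ = fromℕ (suc m) is arbitrary otherwise.
record IsS (m : ℕ) (adj : Adj (suc (suc m))) : Set where
  field
    symm      : ∀ a b → adj a b ≡ adj b a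
    irrefl    : ∀ a → adj a a ≡ false
    path→     : ∀ (i j : Fin (suc m)) → adj (inject₁ i) (inject₁ j) ≡ true →
                  (suc (toℕ i) ≡ toℕ j ⊎ suc (toℕ j) ≡ toℕ i)
    →path     : ∀ (i j : Fin (suc m)) → (suc (toℕ i) ≡ toℕ j ⊎ suc (toℕ j) ≡ toℕ i) →
                  adj (inject₁ i) (inject₁ j) ≡ true
    connected : ∀ a b → Walk adj a b

lastV : ∀ {n'} → Fin (suc n')
lastV {n'} = fromℕ n'

-- bar i  (for i : Fin n) is the paper's  \overline{i+1} = 𝐬_{i} ⋯ 𝐬_{1} \overline 1,
-- i.e. apply the flipping moves of the vertices with index < i, in increasing order,
-- to \overline 1 = s̃₁.
bar : ∀ {n'} → Adj (suc n') → Fin (suc n') → F2^ (suc n')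
bar {n'} adj i =
  foldl (λ v j → flipMat adj j · v) (chr zero)
        (filter (λ j → toℕ j <? toℕ i) (allFin (suc n')))

inΠ₁ : ∀ {n'} → Adj (suc n') → Fin (suc n') → Bool
inΠ₁ adj i = dot (bar adj i) (chr lastV)

cardΠ₁ : ∀ {n'} → Adj (suc n') → ℕ
cardΠ₁ adj = count (inΠ₁ adj)

sumΠ₀ : ∀ {n'} → Adj (suc n') → F2^ (suc n')
sumΠ₀ adj = sumOver (λ i → not (inΠ₁ adj i)) (bar adj)

InU : ∀ {n'} → Adj (suc n') → F2^ (suc n') → Set
InU {n'} adj u = Σ (Fin (suc n') → Bool) (λ E → u ≈ sumOver E (bar adj))

-- Δ = (Π ∪ {\overline{n+1}}) ∖ {\overline n}, indexed by Fin n: slot of \overline n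
-- is replaced by \overline{n+1} = s̃ₙ
Δ : ∀ {n'} → Adj (suc n') → Fin (suc n') → F2^ (suc n')
Δ adj i = if ⌊ i ≟ lastV ⌋ then chr lastV else bar adj i

-- For a subset D ⊆ Δ (given by indices), |Π₁ ∩ D|
kOf : ∀ {n'} → Adj (suc n') → (Fin (suc n') → Bool) → ℕ
kOf adj D = count (λ i → D i ∧ not ⌊ i ≟ lastV ⌋ ∧ inΠ₁ adj i)

Even Odd : ℕ → Set
Even k = k % 2 ≡ 0
Odd k = k % 2 ≡ 1

module Submission where

-- Restricted to the induced path s₁ … sₙ₋₁, the vector \overline i is s̃ᵢ₋₁ + s̃ᵢ (with s̃₀ = 0),
-- and its sₙ-coordinate records whether \overline i ∈ Π₁; so Δ is triangular along the path and
-- Δ-coordinates are unique. The move 𝐬ₙ adds u_{sₙ} times the neighbourhood of sₙ, and that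
-- neighbourhood is Σ_{Π₀}: on sᵢ both are the change of Π₁-membership from \overline i to
-- \overline{i+1}. When |Π₁| is even, \overline n = Σ_{i<n} \overline i, so U is spanned by
-- Δ ∖ {s̃ₙ}: the s̃ₙ-coordinate of u is 0 on U and 1 off U, and u_{sₙ} = k + (that coordinate)
-- mod 2 decides whether 𝐬ₙ fixes u. If it does not, Δ(𝐬ₙ u) = Δ(u) △ Δ(Σ_{Π₀}), and the
-- weights follow from |A △ B| = |A| + |B| − 2 |A ∩ B| and the explicit Δ-coordinates of Σ_{Π₀}.

open import Defs
open import Algebra.Bundles using (CommutativeRing)
open import Data.Bool using (Bool; true; false; _∧_; _xor_; not; if_then_else_)
open import Data.Bool.Properties
  using (∧-assoc; ∧-comm; ∧-zeroʳ; ∧-identityʳ; ∧-inverseˡ; ∧-conicalˡ;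
         ∧-distribˡ-xor; ∧-distribʳ-xor; xor-comm; xor-identityʳ; xor-same; xor-annihilates-not;
         xor-∧-commutativeRing; not-involutive; not-injective; ¬-not; ⇔→≡)
open import Data.Nat as Nat using (ℕ; zero; suc; _*_)
import Data.Nat.Properties as ℕₚ
open import Data.Fin using (Fin; zero; suc; toℕ; inject₁; _≟_)
import Data.Fin.Properties as Fin
open import Data.Product using (_×_; _,_)
open import Data.Sum using (_⊎_; inj₁; inj₂; [_,_])
open import Function using (id; _∘_; flip; _⇔_; mk⇔)
open import Relation.Nullary using (¬_; Dec; yes; no; contradiction)
open import Relation.Nullary.Decidable using (⌊_⌋; dec-true; dec-false; does-⇔; isYes≗does; ⌊⌋-map′)
open import Relation.Binary.PropositionalEquality
  using (_≡_; refl; sym; trans; cong; cong₂; module ≡-Reasoning)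

module Indicators where

  xor-cancelˡ : ∀ x y z → x xor y ≡ x xor z → y ≡ z
  xor-cancelˡ false y z e = e
  xor-cancelˡ true  y z e = not-injective e

  xor-cancelʳ : ∀ x y z → x xor z ≡ y xor z → x ≡ y
  xor-cancelʳ x y z e = xor-cancelˡ z x y (trans (xor-comm z x) (trans e (xor-comm y z)))

  xor-cancel-outer : ∀ x y → (x xor y) xor x ≡ y
  xor-cancel-outer false y     = xor-identityʳ y
  xor-cancel-outer true  false = refl
  xor-cancel-outer true  true  = refl

  ∧-rotate : ∀ x y z → (x ∧ y) ∧ z ≡ y ∧ x ∧ z
  ∧-rotate x y z = trans (cong (_∧ z) (∧-comm x y)) (∧-assoc y x z)

  ⌊⌋-⇔ : ∀ {A B : Set} → A ⇔ B → (a? : Dec A) (b? : Dec B) → ⌊ a? ⌋ ≡ ⌊ b? ⌋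
  ⌊⌋-⇔ A⇔B a? b? = trans (isYes≗does a?) (trans (does-⇔ A⇔B a? b?) (sym (isYes≗does b?)))

  xor-true⇔⊎ : ∀ {P Q : Set} (p : Dec P) (q : Dec Q) → ¬ (P × Q) →
               (⌊ p ⌋ xor ⌊ q ⌋ ≡ true) ⇔ (P ⊎ Q)
  xor-true⇔⊎ (yes p) (yes q) excl = contradiction (p , q) excl
  xor-true⇔⊎ (yes p) (no _)  _    = mk⇔ (λ _ → inj₁ p) (λ _ → refl)
  xor-true⇔⊎ (no _)  (yes q) _    = mk⇔ (λ _ → inj₂ q) (λ _ → refl)
  xor-true⇔⊎ (no ¬p) (no ¬q) _    = mk⇔ (λ ()) [ flip contradiction ¬p , flip contradiction ¬q ]

  chr-true : ∀ {k} {x y : Fin k} → y ≡ x → chr x y ≡ true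
  chr-true {x = x} {y} y≡x = trans (isYes≗does (y ≟ x)) (dec-true (y ≟ x) y≡x)

  chr-false : ∀ {k} {x y : Fin k} → ¬ y ≡ x → chr x y ≡ false
  chr-false {x = x} {y} y≢x = trans (isYes≗does (y ≟ x)) (dec-false (y ≟ x) y≢x)

  chr-refl : ∀ {k} (x : Fin k) → chr x x ≡ true
  chr-refl x = chr-true refl

  chr-sym : ∀ {k} (x y : Fin k) → chr x y ≡ chr y x
  chr-sym x y = ⌊⌋-⇔ (mk⇔ sym sym) (y ≟ x) (x ≟ y)

  chr-suc : ∀ {k} (x y : Fin k) → chr (suc x) (suc y) ≡ chr x y
  chr-suc x y = ⌊⌋-map′ (cong suc) Fin.suc-injective (y ≟ x)

  chr-inject₁ : ∀ {k} (x y : Fin k) → chr (inject₁ x) (inject₁ y) ≡ chr x y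
  chr-inject₁ x y =
    ⌊⌋-⇔ (mk⇔ Fin.inject₁-injective (cong inject₁)) (inject₁ y ≟ inject₁ x) (y ≟ x)

  inject₁≢suc : ∀ {k} (i : Fin k) → ¬ inject₁ i ≡ suc i
  inject₁≢suc i e = ℕₚ.1+n≢n (trans (sym (cong toℕ e)) (Fin.toℕ-inject₁ i))

  isOdd : ℕ → Bool
  isOdd zero    = false
  isOdd (suc k) = not (isOdd k)

  Even⇒¬isOdd : ∀ k → Even k → isOdd k ≡ false
  Even⇒¬isOdd zero          _ = refl
  Even⇒¬isOdd (suc (suc k)) e = trans (not-involutive (isOdd k)) (Even⇒¬isOdd k e)

  Odd⇒isOdd : ∀ k → Odd k → isOdd k ≡ true
  Odd⇒isOdd (suc zero)    _ = refl
  Odd⇒isOdd (suc (suc k)) o = trans (not-involutive (isOdd k)) (Odd⇒isOdd k o)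

module Sums where
  open Indicators
  open Nat using (_+_)
  open import Algebra.Properties.CommutativeSemigroup
    (CommutativeRing.+-commutativeSemigroup xor-∧-commutativeRing) using (interchange)
  open import Data.Nat.Tactic.RingSolver using (solve-∀)

  xorSum-cong : ∀ {k} {f g : Fin k → Bool} → (∀ i → f i ≡ g i) → xorSum f ≡ xorSum g
  xorSum-cong {zero}  _ = refl
  xorSum-cong {suc k} e = cong₂ _xor_ (e zero) (xorSum-cong (e ∘ suc))

  xorSum-false : ∀ {k} → xorSum {k} (λ _ → false) ≡ false
  xorSum-false {zero}  = refl
  xorSum-false {suc k} = xorSum-false {k}

  xorSum-xor : ∀ {k} (f g : Fin k → Bool) → xorSum (λ i → f i xor g i) ≡ xorSum f xor xorSum g
  xorSum-xor {zero}  f g = refl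
  xorSum-xor {suc k} f g = trans (cong ((f zero xor g zero) xor_) (xorSum-xor (f ∘ suc) (g ∘ suc)))
                                 (interchange (f zero) (g zero) _ _)

  xorSum-∧ˡ : ∀ {k} b (f : Fin k → Bool) → xorSum (λ i → b ∧ f i) ≡ b ∧ xorSum f
  xorSum-∧ˡ {k} false f = xorSum-false {k}
  xorSum-∧ˡ     true  f = refl

  xorSum-chr : ∀ {k} (x : Fin k) (f : Fin k → Bool) → xorSum (λ i → chr x i ∧ f i) ≡ f x
  xorSum-chr {suc k} zero    f = trans (cong (f zero xor_) (xorSum-false {k})) (xor-identityʳ (f zero))
  xorSum-chr {suc k} (suc x) f =
    trans (xorSum-cong (λ i → cong (_∧ f (suc i)) (chr-suc x i))) (xorSum-chr x (f ∘ suc))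

  xorSum-chr-xor : ∀ {k} (x y : Fin k) (f : Fin k → Bool) →
                   xorSum (λ i → f i ∧ (chr x i xor chr y i)) ≡ f x xor f y
  xorSum-chr-xor x y f = begin
    xorSum (λ i → f i ∧ (chr x i xor chr y i))
      ≡⟨ xorSum-cong distrib ⟩
    xorSum (λ i → (chr x i ∧ f i) xor (chr y i ∧ f i))
      ≡⟨ xorSum-xor (λ i → chr x i ∧ f i) (λ i → chr y i ∧ f i) ⟩
    xorSum (λ i → chr x i ∧ f i) xor xorSum (λ i → chr y i ∧ f i)
      ≡⟨ cong₂ _xor_ (xorSum-chr x f) (xorSum-chr y f) ⟩
    f x xor f y ∎
    where
    open ≡-Reasoning
    distrib : ∀ i → f i ∧ (chr x i xor chr y i) ≡ (chr x i ∧ f i) xor (chr y i ∧ f i)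
    distrib i = trans (∧-distribˡ-xor (f i) (chr x i) (chr y i))
                      (cong₂ _xor_ (∧-comm (f i) (chr x i)) (∧-comm (f i) (chr y i)))

  xorSum-pick : ∀ {k} (j : Fin k) (f : Fin k → Bool) →
                xorSum f ≡ f j xor xorSum (λ i → not (chr j i) ∧ f i)
  xorSum-pick j f = begin
    xorSum f
      ≡⟨ xorSum-cong split ⟩
    xorSum (λ i → (chr j i ∧ f i) xor (not (chr j i) ∧ f i))
      ≡⟨ xorSum-xor (λ i → chr j i ∧ f i) (λ i → not (chr j i) ∧ f i) ⟩
    xorSum (λ i → chr j i ∧ f i) xor xorSum (λ i → not (chr j i) ∧ f i)
      ≡⟨ cong (_xor xorSum (λ i → not (chr j i) ∧ f i)) (xorSum-chr j f) ⟩
    f j xor xorSum (λ i → not (chr j i) ∧ f i) ∎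
    where
    open ≡-Reasoning
    split : ∀ i → f i ≡ (chr j i ∧ f i) xor (not (chr j i) ∧ f i)
    split i with chr j i
    ... | true  = sym (xor-identityʳ (f i))
    ... | false = refl

  xorSum≡isOdd-count : ∀ {k} (f : Fin k → Bool) → xorSum f ≡ isOdd (count f)
  xorSum≡isOdd-count {zero}  f = refl
  xorSum≡isOdd-count {suc k} f with f zero
  ... | true  = cong not (xorSum≡isOdd-count (f ∘ suc))
  ... | false = xorSum≡isOdd-count (f ∘ suc)

  dot-chr : ∀ {k} (v : Fin k → Bool) (j : Fin k) → dot v (chr j) ≡ v j
  dot-chr v j = trans (xorSum-cong (λ a → ∧-comm (v a) (chr j a))) (xorSum-chr j v)

  count-cong : ∀ {k} {f g : Fin k → Bool} → (∀ i → f i ≡ g i) → count f ≡ count g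
  count-cong {zero}  _ = refl
  count-cong {suc k} e = cong₂ _+_ (cong (λ b → if b then 1 else 0) (e zero)) (count-cong (e ∘ suc))

  count-false : ∀ {k} → count {k} (λ _ → false) ≡ 0
  count-false {zero}  = refl
  count-false {suc k} = count-false {k}

  count-chr : ∀ {k} (j : Fin k) (f : Fin k → Bool) → count (λ i → chr j i ∧ f i) ≡ (if f j then 1 else 0)
  count-chr {suc k} zero    f with f zero
  ... | true  = cong suc (count-false {k})
  ... | false = count-false {k}
  count-chr {suc k} (suc j) f =
    trans (count-cong (λ i → cong (_∧ f (suc i)) (chr-suc j i))) (count-chr j (f ∘ suc))

  count-split : ∀ {k} (f g : Fin k → Bool) →
                count f ≡ count (λ i → f i ∧ g i) + count (λ i → f i ∧ not (g i))
  count-split {zero}  f g = refl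
  count-split {suc k} f g with f zero | g zero | count-split (f ∘ suc) (g ∘ suc)
  ... | false | _     | ih = ih
  ... | true  | true  | ih = cong suc ih
  ... | true  | false | ih = trans (cong suc ih) (sym (ℕₚ.+-suc _ _))

  count+count-not : ∀ {k} (f : Fin k → Bool) → count f + count (not ∘ f) ≡ k
  count+count-not {zero}  f = refl
  count+count-not {suc k} f with f zero | count+count-not (f ∘ suc)
  ... | true  | ih = cong suc ih
  ... | false | ih = trans (ℕₚ.+-suc _ _) (cong suc ih)

  count-xor : ∀ {k} (f g : Fin k → Bool) →
              count (λ i → f i xor g i) + 2 * count (λ i → f i ∧ g i) ≡ count f + count g
  count-xor {zero}  f g = refl
  count-xor {suc k} f g with f zero | g zero | count-xor (f ∘ suc) (g ∘ suc)
  ... | false | false | ih = ih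
  ... | true  | false | ih = cong suc ih
  ... | false | true  | ih = trans (cong suc ih) (sym (ℕₚ.+-suc _ _))
  ... | true  | true  | ih =
    trans (shift₂ _ _) (trans (cong (λ x → Nat.suc (Nat.suc x)) ih) (cong suc (sym (ℕₚ.+-suc _ _))))
    where
    shift₂ : ∀ x h → x + 2 * suc h ≡ suc (suc (x + 2 * h))
    shift₂ = solve-∀

  sumOver-cong : ∀ {k n} (E : Fin k → Bool) {X Y : Fin k → F2^ n} →
                 (∀ i → E i ≡ true → X i ≈ Y i) → sumOver E X ≈ sumOver E Y
  sumOver-cong E {X} {Y} X≈Y a = xorSum-cong pointwise
    where
    pointwise : ∀ i → E i ∧ X i a ≡ E i ∧ Y i a
    pointwise i with E i in Eᵢ
    ... | true  = X≈Y i Eᵢ a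
    ... | false = refl

  sumOver-coeff-cong : ∀ {k n} {E F : Fin k → Bool} (X : Fin k → F2^ n) →
                       (∀ i → E i ≡ F i) → sumOver E X ≈ sumOver F X
  sumOver-coeff-cong X E≡F a = xorSum-cong (λ i → cong (_∧ X i a) (E≡F i))

  sumOver-xor : ∀ {k n} (D G : Fin k → Bool) (X : Fin k → F2^ n) →
                sumOver (λ i → D i xor G i) X ≈ sumOver D X ⊕ sumOver G X
  sumOver-xor D G X a = trans (xorSum-cong (λ i → ∧-distribʳ-xor (X i a) (D i) (G i)))
                              (xorSum-xor (λ i → D i ∧ X i a) (λ i → G i ∧ X i a))

  sumOver-∧ˡ : ∀ {k n} b (E : Fin k → Bool) (X : Fin k → F2^ n) a →
               sumOver (λ i → b ∧ E i) X a ≡ b ∧ sumOver E X a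
  sumOver-∧ˡ b E X a =
    trans (xorSum-cong (λ i → ∧-assoc b (E i) (X i a))) (xorSum-∧ˡ b (λ i → E i ∧ X i a))

  sumOver-pick : ∀ {k n} (j : Fin k) (E : Fin k → Bool) (X : Fin k → F2^ n) a →
                 sumOver E X a ≡ (E j ∧ X j a) xor sumOver (λ i → not (chr j i) ∧ E i) X a
  sumOver-pick j E X a = trans (xorSum-pick j (λ i → E i ∧ X i a))
    (cong ((E j ∧ X j a) xor_) (xorSum-cong (λ i → sym (∧-assoc (not (chr j i)) (E i) (X i a)))))

module FlippingMoves where
  open Indicators
  open Sums
  open import Data.List using (List; []; _∷_; [_]; _++_; map; filter; allFin; foldl)
  open import Data.List.Properties using (filter-none; map-tabulate; map-++; foldl-++)
  open import Data.List.Relation.Unary.All using (universal)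
  open import Data.Nat using (_<?_)

  flipMat-· : ∀ {n} (adj : Adj n) → (∀ a → adj a a ≡ false) → (s : Fin n) (v : F2^ n) →
              flipMat adj s · v ≈ v ⊕ (λ a → adj a s ∧ v s)
  flipMat-· adj irrefl s v a = begin
    xorSum (λ b → flipMat adj s a b ∧ v b)
      ≡⟨ xorSum-cong entry ⟩
    xorSum (λ b → (chr a b ∧ v b) xor (chr s b ∧ adj a b ∧ v b))
      ≡⟨ xorSum-xor (λ b → chr a b ∧ v b) (λ b → chr s b ∧ adj a b ∧ v b) ⟩
    xorSum (λ b → chr a b ∧ v b) xor xorSum (λ b → chr s b ∧ adj a b ∧ v b)
      ≡⟨ cong₂ _xor_ (xorSum-chr a v) (xorSum-chr s (λ b → adj a b ∧ v b)) ⟩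
    v a xor (adj a s ∧ v s) ∎
    where
    open ≡-Reasoning
    entry : ∀ b → flipMat adj s a b ∧ v b ≡ (chr a b ∧ v b) xor (chr s b ∧ adj a b ∧ v b)
    entry b with a ≟ b
    ... | yes refl = sym (trans (cong₂ _xor_ (cong (_∧ v b) (chr-refl b)) no-loop) (xor-identityʳ (v b)))
      where
      no-loop : chr s b ∧ adj b b ∧ v b ≡ false
      no-loop = trans (cong (λ x → chr s b ∧ x ∧ v b) (irrefl b)) (∧-zeroʳ (chr s b))
    ... | no a≢b  = trans (∧-assoc (chr s b) (adj a b) (v b))
                          (cong (λ x → (x ∧ v b) xor (chr s b ∧ adj a b ∧ v b))
                                (sym (chr-false (a≢b ∘ sym))))

  below : ∀ N → ℕ → List (Fin N)
  below N t = filter (λ j → toℕ j <? t) (allFin N)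

  below-zero : ∀ N → below N 0 ≡ []
  below-zero N = filter-none (λ j → toℕ j <? 0) (universal (λ _ ()) (allFin N))

  filter-<?-map-suc : ∀ {N} t (xs : List (Fin N)) →
                      filter (λ j → toℕ j <? suc t) (map suc xs) ≡ map suc (filter (λ j → toℕ j <? t) xs)
  filter-<?-map-suc t []       = refl
  filter-<?-map-suc t (x ∷ xs) with toℕ x Nat.<ᵇ t
  ... | true  = cong (suc x ∷_) (filter-<?-map-suc t xs)
  ... | false = filter-<?-map-suc t xs

  below-suc : ∀ N t → below (suc N) (suc t) ≡ zero ∷ map suc (below N t)
  below-suc N t = cong (zero ∷_) (trans (cong (filter (λ j → toℕ j <? suc t)) (sym (map-tabulate id suc)))
                                        (filter-<?-map-suc t (allFin N)))

  below-snoc : ∀ {N} (i : Fin N) → below N (suc (toℕ i)) ≡ below N (toℕ i) ++ [ i ]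
  below-snoc {suc N} zero    = begin
    below (suc N) 1                    ≡⟨ below-suc N 0 ⟩
    zero ∷ map suc (below N 0)         ≡⟨ cong (λ xs → zero ∷ map suc xs) (below-zero N) ⟩
    [ zero ]                           ≡⟨ cong (_++ [ zero ]) (sym (below-zero (suc N))) ⟩
    below (suc N) 0 ++ [ zero ]        ∎
    where open ≡-Reasoning
  below-snoc {suc N} (suc i) = begin
    below (suc N) (suc (suc (toℕ i)))              ≡⟨ below-suc N (suc (toℕ i)) ⟩
    zero ∷ map suc (below N (suc (toℕ i)))         ≡⟨ cong (λ xs → zero ∷ map suc xs) (below-snoc i) ⟩
    zero ∷ map suc (below N (toℕ i) ++ [ i ])      ≡⟨ cong (zero ∷_) (map-++ suc (below N (toℕ i)) [ i ]) ⟩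
    zero ∷ map suc (below N (toℕ i)) ++ [ suc i ]  ≡⟨ cong (_++ [ suc i ]) (sym (below-suc N (toℕ i))) ⟩
    below (suc N) (suc (toℕ i)) ++ [ suc i ]       ∎
    where open ≡-Reasoning

  bar-zero : ∀ {n'} (adj : Adj (suc n')) → bar adj zero ≡ chr zero
  bar-zero {n'} adj = cong (foldl (λ v j → flipMat adj j · v) (chr zero)) (below-zero (suc n'))

  bar-suc : ∀ {n'} (adj : Adj (suc n')) (i : Fin n') →
            bar adj (suc i) ≡ flipMat adj (inject₁ i) · bar adj (inject₁ i)
  bar-suc {n'} adj i = begin
    foldl move (chr zero) (below (suc n') (suc (toℕ i)))
      ≡⟨ cong (λ t → foldl move (chr zero) (below (suc n') (suc t))) (sym (Fin.toℕ-inject₁ i)) ⟩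
    foldl move (chr zero) (below (suc n') (suc (toℕ (inject₁ i))))
      ≡⟨ cong (foldl move (chr zero)) (below-snoc (inject₁ i)) ⟩
    foldl move (chr zero) (below (suc n') (toℕ (inject₁ i)) ++ [ inject₁ i ])
      ≡⟨ foldl-++ move (chr zero) (below (suc n') (toℕ (inject₁ i))) [ inject₁ i ] ⟩
    flipMat adj (inject₁ i) · bar adj (inject₁ i) ∎
    where
    open ≡-Reasoning
    move : F2^ (suc n') → Fin (suc n') → F2^ (suc n')
    move v j = flipMat adj j · v

module SymmetricDifferenceWeight where
  open Nat using (_+_)
  open import Data.Integer as ℤ using (+_)
  import Data.Integer.Properties as ℤₚ
  import Data.Nat.Tactic.RingSolver as ℕ-Solver
  import Data.Integer.Tactic.RingSolver as ℤ-Solver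

  cancel-into-ℤ : ∀ {x y z} → x + y ≡ z → + x ≡ + z ℤ.- + y
  cancel-into-ℤ {x} {y} refl = trans (identity (+ x) (+ y)) (cong (ℤ._- + y) (sym (ℤₚ.pos-+ x y)))
    where
    identity : ∀ a b → a ≡ (a ℤ.+ b) ℤ.- b
    identity = ℤ-Solver.solve-∀

  symdiff-weight : ∀ {x a g h} → x + 2 * h ≡ a + g → + x ≡ + a ℤ.+ + g ℤ.- + (2 * h)
  symdiff-weight {x} {a} {g} {h} e =
    trans (cancel-into-ℤ {x} {2 * h} e) (cong (ℤ._- + (2 * h)) (ℤₚ.pos-+ a g))

  symdiff-weight-complement : ∀ {x a g h k c N} d → x + 2 * h ≡ a + g → g + c ≡ N → a ≡ d + k + h →
                              + x ≡ + N ℤ.- + c ℤ.+ + (2 * k) ℤ.+ + (2 * d) ℤ.- + a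
  symdiff-weight-complement {x} {g = g} {h} {k} {c} d x+2h≡a+g refl refl = begin
    + x
      ≡⟨ cancel-into-ℤ (ℕₚ.+-cancelʳ-≡ h _ _ swapped) ⟩
    + (g + c + 2 * k + 2 * d) ℤ.- + (c + a)
      ≡⟨ cong₂ ℤ._-_ expand (ℤₚ.pos-+ c a) ⟩
    (+ (g + c) ℤ.+ + (2 * k) ℤ.+ + (2 * d)) ℤ.- (+ c ℤ.+ + a)
      ≡⟨ regroup (+ (g + c)) (+ (2 * k)) (+ (2 * d)) (+ c) (+ a) ⟩
    + (g + c) ℤ.- + c ℤ.+ + (2 * k) ℤ.+ + (2 * d) ℤ.- + a ∎
    where
    open ≡-Reasoning
    a = d + k + h
    regroupˡ : ∀ x h c d k → x + (c + (d + k + h)) + h ≡ (x + 2 * h) + (c + d + k)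
    regroupˡ = ℕ-Solver.solve-∀
    regroupʳ : ∀ d k h g c → (d + k + h + g) + (c + d + k) ≡ g + c + 2 * k + 2 * d + h
    regroupʳ = ℕ-Solver.solve-∀
    swapped : x + (c + a) + h ≡ g + c + 2 * k + 2 * d + h
    swapped = trans (regroupˡ x h c d k) (trans (cong (_+ (c + d + k)) x+2h≡a+g) (regroupʳ d k h g c))
    expand : + (g + c + 2 * k + 2 * d) ≡ + (g + c) ℤ.+ + (2 * k) ℤ.+ + (2 * d)
    expand = trans (ℤₚ.pos-+ (g + c + 2 * k) (2 * d)) (cong (ℤ._+ + (2 * d)) (ℤₚ.pos-+ (g + c) (2 * k)))
    regroup : ∀ N s t c a → (N ℤ.+ s ℤ.+ t) ℤ.- (c ℤ.+ a) ≡ N ℤ.- c ℤ.+ s ℤ.+ t ℤ.- a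
    regroup = ℤ-Solver.solve-∀

module PathGraph (m : ℕ) (adj : Adj (suc (suc m))) (S : IsS m adj) where
  open IsS S
  open Indicators
  open Sums
  open FlippingMoves
  open SymmetricDifferenceWeight
  open Nat using (_+_)
  open import Data.Integer as ℤ using (+_)
  import Data.Sum as Sum
  open import Data.Fin.Induction using (<-weakInduction; >-weakInduction)
  open import Data.Fin.Relation.Unary.Top using (view; ‵fromℕ; ‵inj₁)
  open import Function.Construct.Composition using (_⇔-∘_)
  open import Function.Construct.Symmetry using (⇔-sym)

  L : Fin (suc (suc m))
  L = lastV

  notLast : Fin (suc (suc m)) → Bool
  notLast i = not (chr L i)

  notLast-last : notLast L ≡ false
  notLast-last = cong not (chr-refl L)

  chr-last-inject₁ : (a : Fin (suc m)) → chr L (inject₁ a) ≡ false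
  chr-last-inject₁ a = chr-false (Fin.fromℕ≢inject₁ ∘ sym)

  notLast-inject₁ : (a : Fin (suc m)) → notLast (inject₁ a) ≡ true
  notLast-inject₁ a = cong not (chr-last-inject₁ a)

  notLast-absorb : (f : Fin (suc (suc m)) → Bool) → f L ≡ false → ∀ i → notLast i ∧ f i ≡ f i
  notLast-absorb f fL≡false i with view i
  ... | ‵fromℕ          = trans (cong (_∧ f L) notLast-last) (sym fL≡false)
  ... | ‵inj₁ {i = a} _ = cong (_∧ f (inject₁ a)) (notLast-inject₁ a)

  path-adj : (a i : Fin (suc m)) →
             adj (inject₁ a) (inject₁ i) ≡ chr (suc a) (inject₁ i) xor chr (inject₁ a) (suc i)
  path-adj a i = ⇔→≡ (⇔-sym (xor-true⇔⊎ (inject₁ i ≟ suc a) (suc i ≟ inject₁ a) not-both)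
                      ⇔-∘ (consecutive ⇔-∘ mk⇔ (path→ a i) (→path a i)))
    where
    toℕ-of : ∀ {j : Fin (suc m)} {t} → inject₁ j ≡ suc t → toℕ j ≡ suc (toℕ t)
    toℕ-of {j} e = trans (sym (Fin.toℕ-inject₁ j)) (cong toℕ e)
    from-toℕ : ∀ {j : Fin (suc m)} {t} → toℕ j ≡ suc (toℕ t) → inject₁ j ≡ suc t
    from-toℕ {j} e = Fin.toℕ-injective (trans (Fin.toℕ-inject₁ j) e)
    consecutive : (suc (toℕ a) ≡ toℕ i ⊎ suc (toℕ i) ≡ toℕ a)
                ⇔ (inject₁ i ≡ suc a ⊎ suc i ≡ inject₁ a)
    consecutive = mk⇔ (Sum.map (from-toℕ ∘ sym) (sym ∘ from-toℕ ∘ sym))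
                      (Sum.map (sym ∘ toℕ-of) (sym ∘ toℕ-of ∘ sym))
    not-both : ¬ (inject₁ i ≡ suc a × suc i ≡ inject₁ a)
    not-both (i≡a+1 , i+1≡a) =
      ℕₚ.m≢1+n+m (toℕ a) {1} (trans (toℕ-of (sym i+1≡a)) (cong suc (toℕ-of i≡a+1)))

  bar-suc-at : (i : Fin (suc m)) (a : Fin (suc (suc m))) →
               bar adj (suc i) a
               ≡ bar adj (inject₁ i) a xor (adj a (inject₁ i) ∧ bar adj (inject₁ i) (inject₁ i))
  bar-suc-at i a =
    trans (cong (λ v → v a) (bar-suc adj i)) (flipMat-· adj irrefl (inject₁ i) (bar adj (inject₁ i)) a)

  bar-path : (i : Fin (suc (suc m))) (a : Fin (suc m)) →
             bar adj i (inject₁ a) ≡ chr (suc a) i xor chr (inject₁ a) i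
  bar-path = <-weakInduction _ base next
    where
    base : ∀ a → bar adj zero (inject₁ a) ≡ chr (suc a) zero xor chr (inject₁ a) zero
    base a = trans (cong (λ v → v (inject₁ a)) (bar-zero adj)) (chr-sym zero (inject₁ a))
    cancel : ∀ x y z → (x xor y) xor ((x xor z) ∧ true) ≡ y xor z
    cancel false y z = cong (y xor_) (∧-identityʳ z)
    cancel true  y z = trans (cong (not y xor_) (∧-identityʳ (not z))) (xor-annihilates-not y z)
    next : ∀ i →
           (∀ a → bar adj (inject₁ i) (inject₁ a) ≡ chr (suc a) (inject₁ i) xor chr (inject₁ a) (inject₁ i)) →
           ∀ a → bar adj (suc i) (inject₁ a) ≡ chr (suc a) (suc i) xor chr (inject₁ a) (suc i)
    next i IH a = begin
      bar adj (suc i) (inject₁ a)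
        ≡⟨ bar-suc-at i (inject₁ a) ⟩
      bar adj (inject₁ i) (inject₁ a) xor (adj (inject₁ a) (inject₁ i) ∧ bar adj (inject₁ i) (inject₁ i))
        ≡⟨ cong₂ _xor_ (IH a) (cong₂ _∧_ (path-adj a i) diagonal) ⟩
      (chr (suc a) (inject₁ i) xor chr (inject₁ a) (inject₁ i))
        xor ((chr (suc a) (inject₁ i) xor chr (inject₁ a) (suc i)) ∧ true)
        ≡⟨ cancel (chr (suc a) (inject₁ i)) (chr (inject₁ a) (inject₁ i)) (chr (inject₁ a) (suc i)) ⟩
      chr (inject₁ a) (inject₁ i) xor chr (inject₁ a) (suc i)
        ≡⟨ cong (_xor chr (inject₁ a) (suc i)) (trans (chr-inject₁ a i) (sym (chr-suc a i))) ⟩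
      chr (suc a) (suc i) xor chr (inject₁ a) (suc i) ∎
      where
      open ≡-Reasoning
      diagonal : bar adj (inject₁ i) (inject₁ i) ≡ true
      diagonal = trans (IH i) (cong₂ _xor_ (chr-false (inject₁≢suc i)) (chr-refl (inject₁ i)))

  bar-diagonal : (i : Fin (suc m)) → bar adj (inject₁ i) (inject₁ i) ≡ true
  bar-diagonal i =
    trans (bar-path (inject₁ i) i) (cong₂ _xor_ (chr-false (inject₁≢suc i)) (chr-refl (inject₁ i)))

  sumOver-bar-path : (E : Fin (suc (suc m)) → Bool) (a : Fin (suc m)) →
                     sumOver E (bar adj) (inject₁ a) ≡ E (suc a) xor E (inject₁ a)
  sumOver-bar-path E a =
    trans (xorSum-cong (λ i → cong (E i ∧_) (bar-path i a))) (xorSum-chr-xor (suc a) (inject₁ a) E)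

  inΠ₁≡bar-last : ∀ i → inΠ₁ adj i ≡ bar adj i L
  inΠ₁≡bar-last i = dot-chr (bar adj i) L

  inΠ₁-suc : (i : Fin (suc m)) → inΠ₁ adj (suc i) ≡ inΠ₁ adj (inject₁ i) xor adj L (inject₁ i)
  inΠ₁-suc i = begin
    inΠ₁ adj (suc i)
      ≡⟨ inΠ₁≡bar-last (suc i) ⟩
    bar adj (suc i) L
      ≡⟨ bar-suc-at i L ⟩
    bar adj (inject₁ i) L xor (adj L (inject₁ i) ∧ bar adj (inject₁ i) (inject₁ i))
      ≡⟨ cong₂ (λ x y → x xor (adj L (inject₁ i) ∧ y))
               (sym (inΠ₁≡bar-last (inject₁ i))) (bar-diagonal i) ⟩
    inΠ₁ adj (inject₁ i) xor (adj L (inject₁ i) ∧ true)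
      ≡⟨ cong (inΠ₁ adj (inject₁ i) xor_) (∧-identityʳ _) ⟩
    inΠ₁ adj (inject₁ i) xor adj L (inject₁ i) ∎
    where open ≡-Reasoning

  adj-last≈sumΠ₀ : (λ a → adj a L) ≈ sumΠ₀ adj
  adj-last≈sumΠ₀ a with view a
  ... | ‵fromℕ = trans (irrefl L) (sym (trans (xorSum-cong Π₀∩Π₁) (xorSum-false {suc (suc m)})))
    where
    Π₀∩Π₁ : ∀ i → not (inΠ₁ adj i) ∧ bar adj i L ≡ false
    Π₀∩Π₁ i = trans (cong (not (inΠ₁ adj i) ∧_) (sym (inΠ₁≡bar-last i))) (∧-inverseˡ (inΠ₁ adj i))
  ... | ‵inj₁ {i = b} _ = sym (begin
    sumOver (not ∘ inΠ₁ adj) (bar adj) (inject₁ b)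
      ≡⟨ sumOver-bar-path (not ∘ inΠ₁ adj) b ⟩
    not (inΠ₁ adj (suc b)) xor not (inΠ₁ adj (inject₁ b))
      ≡⟨ xor-annihilates-not (inΠ₁ adj (suc b)) _ ⟩
    inΠ₁ adj (suc b) xor inΠ₁ adj (inject₁ b)
      ≡⟨ cong (_xor inΠ₁ adj (inject₁ b)) (inΠ₁-suc b) ⟩
    (inΠ₁ adj (inject₁ b) xor adj L (inject₁ b)) xor inΠ₁ adj (inject₁ b)
      ≡⟨ xor-cancel-outer (inΠ₁ adj (inject₁ b)) _ ⟩
    adj L (inject₁ b)
      ≡⟨ symm L (inject₁ b) ⟩
    adj (inject₁ b) L ∎)
    where open ≡-Reasoning

  Δ-last : Δ adj L ≡ chr L
  Δ-last = cong (λ b → if b then chr L else bar adj L) (chr-refl L)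

  Δ-notLast : ∀ i → notLast i ≡ true → Δ adj i ≈ bar adj i
  Δ-notLast i h a =
    cong (λ b → (if b then chr L else bar adj i) a) (trans (sym (not-involutive (chr L i))) (cong not h))

  sumOver-Δ : ∀ D a →
              sumOver D (Δ adj) a ≡ (D L ∧ chr L a) xor sumOver (λ i → notLast i ∧ D i) (bar adj) a
  sumOver-Δ D a = trans (sumOver-pick L D (Δ adj) a)
    (cong₂ _xor_ (cong (λ v → D L ∧ v a) Δ-last)
                 (sumOver-cong (λ i → notLast i ∧ D i)
                               (λ i h → Δ-notLast i (∧-conicalˡ (notLast i) (D i) h)) a))

  sumOver-Δ-path : ∀ D (a : Fin (suc m)) →
                   sumOver D (Δ adj) (inject₁ a) ≡ (notLast (suc a) ∧ D (suc a)) xor D (inject₁ a)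
  sumOver-Δ-path D a = begin
    sumOver D (Δ adj) (inject₁ a)
      ≡⟨ sumOver-Δ D (inject₁ a) ⟩
    (D L ∧ chr L (inject₁ a)) xor sumOver (λ i → notLast i ∧ D i) (bar adj) (inject₁ a)
      ≡⟨ cong₂ _xor_ (trans (cong (D L ∧_) (chr-last-inject₁ a)) (∧-zeroʳ (D L)))
                     (sumOver-bar-path (λ i → notLast i ∧ D i) a) ⟩
    (notLast (suc a) ∧ D (suc a)) xor (notLast (inject₁ a) ∧ D (inject₁ a))
      ≡⟨ cong (λ x → (notLast (suc a) ∧ D (suc a)) xor (x ∧ D (inject₁ a))) (notLast-inject₁ a) ⟩
    (notLast (suc a) ∧ D (suc a)) xor D (inject₁ a) ∎
    where open ≡-Reasoning

  sumOver-Δ-last : ∀ D → sumOver D (Δ adj) L ≡ D L xor isOdd (kOf adj D)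
  sumOver-Δ-last D = begin
    sumOver D (Δ adj) L
      ≡⟨ sumOver-Δ D L ⟩
    (D L ∧ chr L L) xor xorSum (λ i → (notLast i ∧ D i) ∧ bar adj i L)
      ≡⟨ cong₂ _xor_ (trans (cong (D L ∧_) (chr-refl L)) (∧-identityʳ (D L))) (xorSum-cong rearrange) ⟩
    D L xor xorSum (λ i → D i ∧ notLast i ∧ inΠ₁ adj i)
      ≡⟨ cong (D L xor_) (xorSum≡isOdd-count (λ i → D i ∧ notLast i ∧ inΠ₁ adj i)) ⟩
    D L xor isOdd (kOf adj D) ∎
    where
    open ≡-Reasoning
    rearrange : ∀ i → (notLast i ∧ D i) ∧ bar adj i L ≡ D i ∧ notLast i ∧ inΠ₁ adj i
    rearrange i = trans (∧-rotate (notLast i) (D i) (bar adj i L))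
                        (cong (λ x → D i ∧ notLast i ∧ x) (sym (inΠ₁≡bar-last i)))

  -- Δ is triangular: the path coordinates determine the coefficients of Δ ∖ {s̃ₙ} from sₙ₋₁ down,
  -- after which the sₙ-coordinate determines the coefficient of s̃ₙ.
  Δ-coords-unique : ∀ D D' → sumOver D (Δ adj) ≈ sumOver D' (Δ adj) → ∀ i → D i ≡ D' i
  Δ-coords-unique D D' same = coordinate
    where
    off-last : ∀ i → notLast i ∧ D i ≡ notLast i ∧ D' i
    off-last = >-weakInduction _ at-last downward
      where
      at-last : notLast L ∧ D L ≡ notLast L ∧ D' L
      at-last = trans (cong (_∧ D L) notLast-last) (sym (cong (_∧ D' L) notLast-last))
      downward : ∀ a → notLast (suc a) ∧ D (suc a) ≡ notLast (suc a) ∧ D' (suc a) →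
                 notLast (inject₁ a) ∧ D (inject₁ a) ≡ notLast (inject₁ a) ∧ D' (inject₁ a)
      downward a above = trans (cong (_∧ D (inject₁ a)) (notLast-inject₁ a))
        (trans (xor-cancelˡ (notLast (suc a) ∧ D (suc a)) _ _ path-coordinate)
               (sym (cong (_∧ D' (inject₁ a)) (notLast-inject₁ a))))
        where
        path-coordinate : (notLast (suc a) ∧ D (suc a)) xor D (inject₁ a)
                        ≡ (notLast (suc a) ∧ D (suc a)) xor D' (inject₁ a)
        path-coordinate = trans (sym (sumOver-Δ-path D a)) (trans (same (inject₁ a))
                                (trans (sumOver-Δ-path D' a) (cong (_xor D' (inject₁ a)) (sym above))))
    same-k : kOf adj D ≡ kOf adj D'
    same-k = count-cong λ i →
      trans (sym (∧-rotate (notLast i) (D i) (inΠ₁ adj i)))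
            (trans (cong (_∧ inΠ₁ adj i) (off-last i)) (∧-rotate (notLast i) (D' i) (inΠ₁ adj i)))
    coordinate : ∀ i → D i ≡ D' i
    coordinate i with view i
    ... | ‵fromℕ = xor-cancelʳ (D L) (D' L) (isOdd (kOf adj D))
          (trans (sym (sumOver-Δ-last D))
                 (trans (same L) (trans (sumOver-Δ-last D') (cong (λ k → D' L xor isOdd k) (sym same-k)))))
    ... | ‵inj₁ {i = a} _ = trans (cong (_∧ D (inject₁ a)) (sym (notLast-inject₁ a)))
                                  (trans (off-last (inject₁ a)) (cong (_∧ D' (inject₁ a)) (notLast-inject₁ a)))

  last-coord : ∀ u D → u ≈ sumOver D (Δ adj) → u L ≡ isOdd (kOf adj D) xor D L
  last-coord u D u≈ = trans (u≈ L) (trans (sumOver-Δ-last D) (xor-comm (D L) _))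

  ¬InU⇒last-coord-true : ∀ u D → u ≈ sumOver D (Δ adj) → ¬ InU adj u → D L ≡ true
  ¬InU⇒last-coord-true u D u≈ u∉U = ¬-not λ DL≡false → u∉U ((λ i → notLast i ∧ D i) , λ a →
    trans (u≈ a) (trans (sumOver-Δ D a)
                        (cong (λ b → (b ∧ chr L a) xor sumOver (λ i → notLast i ∧ D i) (bar adj) a) DL≡false)))

  flip-fixes : ∀ u → u L ≡ false → flipMat adj L · u ≈ u
  flip-fixes u uL≡false a = trans (flipMat-· adj irrefl L u a)
    (trans (cong (λ b → u a xor (adj a L ∧ b)) uL≡false)
           (trans (cong (u a xor_) (∧-zeroʳ (adj a L))) (xor-identityʳ (u a))))

  flip-adds-Π₀ : ∀ u → u L ≡ true → flipMat adj L · u ≈ u ⊕ sumΠ₀ adj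
  flip-adds-Π₀ u uL≡true a = trans (flipMat-· adj irrefl L u a)
    (cong (u a xor_) (trans (cong (adj a L ∧_) uL≡true) (trans (∧-identityʳ (adj a L)) (adj-last≈sumΠ₀ a))))

  fixed-weight : ∀ u D D' → u ≈ sumOver D (Δ adj) → flipMat adj L · u ≈ sumOver D' (Δ adj) →
                 u L ≡ false → count D' ≡ count D
  fixed-weight u D D' u≈ u'≈ uL≡false =
    count-cong (Δ-coords-unique D' D λ a → trans (sym (u'≈ a)) (trans (flip-fixes u uL≡false a) (u≈ a)))

  module _ (Π₁-even : Even (cardΠ₁ adj)) where

    bar-last≈sum-others : bar adj L ≈ sumOver notLast (bar adj)
    bar-last≈sum-others a with view a
    ... | ‵fromℕ = begin
      bar adj L L
        ≡⟨ sym (inΠ₁≡bar-last L) ⟩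
      inΠ₁ adj L
        ≡⟨ xor-cancelˡ (inΠ₁ adj L) _ _ (trans (xor-same (inΠ₁ adj L)) total-parity) ⟩
      xorSum (λ i → notLast i ∧ inΠ₁ adj i)
        ≡⟨ xorSum-cong (λ i → cong (notLast i ∧_) (inΠ₁≡bar-last i)) ⟩
      xorSum (λ i → notLast i ∧ bar adj i L) ∎
      where
      open ≡-Reasoning
      total-parity : false ≡ inΠ₁ adj L xor xorSum (λ i → notLast i ∧ inΠ₁ adj i)
      total-parity = trans (sym (Even⇒¬isOdd (cardΠ₁ adj) Π₁-even))
                           (trans (sym (xorSum≡isOdd-count (inΠ₁ adj))) (xorSum-pick L (inΠ₁ adj)))
    ... | ‵inj₁ {i = a} _ = begin
      bar adj L (inject₁ a)
        ≡⟨ bar-path L a ⟩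
      chr (suc a) L xor chr (inject₁ a) L
        ≡⟨ cong₂ _xor_ (chr-sym (suc a) L) (chr-false Fin.fromℕ≢inject₁) ⟩
      chr L (suc a) xor false
        ≡⟨ xor-identityʳ (chr L (suc a)) ⟩
      chr L (suc a)
        ≡⟨ sym (trans (xor-comm (notLast (suc a)) true) (not-involutive (chr L (suc a)))) ⟩
      notLast (suc a) xor true
        ≡⟨ cong (notLast (suc a) xor_) (sym (notLast-inject₁ a)) ⟩
      notLast (suc a) xor notLast (inject₁ a)
        ≡⟨ sym (sumOver-bar-path notLast a) ⟩
      sumOver notLast (bar adj) (inject₁ a) ∎
      where open ≡-Reasoning

    sumOver-bar≈sumOver-Δ : ∀ E →
                            sumOver E (bar adj) ≈ sumOver (λ i → notLast i ∧ (E i xor E L)) (Δ adj)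
    sumOver-bar≈sumOver-Δ E a = begin
      sumOver E (bar adj) a
        ≡⟨ sumOver-pick L E (bar adj) a ⟩
      (E L ∧ bar adj L a) xor sumOver E° (bar adj) a
        ≡⟨ cong (λ x → (E L ∧ x) xor sumOver E° (bar adj) a) (bar-last≈sum-others a) ⟩
      (E L ∧ sumOver notLast (bar adj) a) xor sumOver E° (bar adj) a
        ≡⟨ cong (_xor sumOver E° (bar adj) a) (sym (sumOver-∧ˡ (E L) notLast (bar adj) a)) ⟩
      sumOver (λ i → E L ∧ notLast i) (bar adj) a xor sumOver E° (bar adj) a
        ≡⟨ sym (sumOver-xor (λ i → E L ∧ notLast i) E° (bar adj) a) ⟩
      sumOver (λ i → (E L ∧ notLast i) xor E° i) (bar adj) a
        ≡⟨ sumOver-coeff-cong (bar adj) collect a ⟩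
      sumOver (λ i → notLast i ∧ (E i xor E L)) (bar adj) a
        ≡⟨ sumOver-cong (λ i → notLast i ∧ (E i xor E L))
                        (λ i h → sym ∘ Δ-notLast i (∧-conicalˡ (notLast i) _ h)) a ⟩
      sumOver (λ i → notLast i ∧ (E i xor E L)) (Δ adj) a ∎
      where
      open ≡-Reasoning
      E° : Fin (suc (suc m)) → Bool
      E° i = notLast i ∧ E i
      collect : ∀ i → (E L ∧ notLast i) xor E° i ≡ notLast i ∧ (E i xor E L)
      collect i = trans (cong (_xor E° i) (∧-comm (E L) (notLast i)))
                        (trans (xor-comm (notLast i ∧ E L) (E° i))
                               (sym (∧-distribˡ-xor (notLast i) (E i) (E L))))

    InU⇒last-coord-false : ∀ u D → u ≈ sumOver D (Δ adj) → InU adj u → D L ≡ false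
    InU⇒last-coord-false u D u≈ (E , u≈E) =
      trans (Δ-coords-unique D (λ i → notLast i ∧ (E i xor E L))
                             (λ a → trans (sym (u≈ a)) (trans (u≈E a) (sumOver-bar≈sumOver-Δ E a))) L)
            (cong (_∧ (E L xor E L)) notLast-last)

    Π₀-coords : Fin (suc (suc m)) → Bool
    Π₀-coords i = notLast i ∧ (not (inΠ₁ adj i) xor not (inΠ₁ adj L))

    sumΠ₀≈ : sumΠ₀ adj ≈ sumOver Π₀-coords (Δ adj)
    sumΠ₀≈ = sumOver-bar≈sumOver-Δ (not ∘ inΠ₁ adj)

    moved-coords : ∀ u D D' → u ≈ sumOver D (Δ adj) → flipMat adj L · u ≈ u ⊕ sumΠ₀ adj →
                   flipMat adj L · u ≈ sumOver D' (Δ adj) → ∀ i → D' i ≡ D i xor Π₀-coords i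
    moved-coords u D D' u≈ moved u'≈ = Δ-coords-unique D' (λ i → D i xor Π₀-coords i) λ a →
      trans (sym (u'≈ a)) (trans (moved a)
            (trans (cong₂ _xor_ (u≈ a) (sumΠ₀≈ a)) (sym (sumOver-xor D Π₀-coords (Δ adj) a))))

    moved-count : ∀ u D D' → u ≈ sumOver D (Δ adj) → flipMat adj L · u ≈ sumOver D' (Δ adj) →
                  u L ≡ true → count D' + 2 * count (λ i → D i ∧ Π₀-coords i) ≡ count D + count Π₀-coords
    moved-count u D D' u≈ u'≈ uL≡true =
      trans (cong (_+ 2 * count (λ i → D i ∧ Π₀-coords i))
                  (count-cong (moved-coords u D D' u≈ (flip-adds-Π₀ u uL≡true) u'≈)))
            (count-xor D Π₀-coords)

    module _ (last∈Π₁ : inΠ₁ adj L ≡ true) where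

      Π₀-coords-∈ : ∀ i → Π₀-coords i ≡ notLast i ∧ not (inΠ₁ adj i)
      Π₀-coords-∈ i =
        cong (notLast i ∧_) (trans (cong (λ b → not (inΠ₁ adj i) xor not b) last∈Π₁) (xor-identityʳ _))

      Π₀-count-∈ : count Π₀-coords + cardΠ₁ adj ≡ suc (suc m)
      Π₀-count-∈ = trans (cong (_+ cardΠ₁ adj) (count-cong Π₀-coords≡Π₀))
                         (trans (ℕₚ.+-comm _ (cardΠ₁ adj)) (count+count-not (inΠ₁ adj)))
        where
        Π₀-coords≡Π₀ : ∀ i → Π₀-coords i ≡ not (inΠ₁ adj i)
        Π₀-coords≡Π₀ i =
          trans (Π₀-coords-∈ i) (notLast-absorb (not ∘ inΠ₁ adj) (cong not last∈Π₁) i)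

      count-decomposition-∈ : ∀ D {b} → D L ≡ b →
                              count D ≡ (if b then 1 else 0) + kOf adj D + count (λ i → D i ∧ Π₀-coords i)
      count-decomposition-∈ D refl = begin
        count D
          ≡⟨ count-split D (chr L) ⟩
        count (λ i → D i ∧ chr L i) + count D°
          ≡⟨ cong₂ _+_ (trans (count-cong (λ i → ∧-comm (D i) (chr L i))) (count-chr L D))
                       (count-split D° (inΠ₁ adj)) ⟩
        DL-bit + (count (λ i → D° i ∧ inΠ₁ adj i) + count (λ i → D° i ∧ not (inΠ₁ adj i)))
          ≡⟨ cong (λ x → DL-bit + x) (cong₂ _+_ (count-cong (λ i → ∧-assoc (D i) (notLast i) (inΠ₁ adj i)))
                                       (count-cong outside-Π₁)) ⟩
        DL-bit + (kOf adj D + count (λ i → D i ∧ Π₀-coords i))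
          ≡⟨ sym (ℕₚ.+-assoc DL-bit (kOf adj D) _) ⟩
        DL-bit + kOf adj D + count (λ i → D i ∧ Π₀-coords i) ∎
        where
        open ≡-Reasoning
        D° : Fin (suc (suc m)) → Bool
        D° i = D i ∧ notLast i
        DL-bit : ℕ
        DL-bit = if D L then 1 else 0
        outside-Π₁ : ∀ i → D° i ∧ not (inΠ₁ adj i) ≡ D i ∧ Π₀-coords i
        outside-Π₁ i = trans (∧-assoc (D i) (notLast i) _) (cong (D i ∧_) (sym (Π₀-coords-∈ i)))

      moved-weight-∈ : ∀ u D D' {b} → u ≈ sumOver D (Δ adj) → flipMat adj L · u ≈ sumOver D' (Δ adj) →
                       u L ≡ true → D L ≡ b →
                       + count D' ≡ + suc (suc m) ℤ.- + cardΠ₁ adj ℤ.+ + (2 * kOf adj D)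
                                    ℤ.+ + (2 * (if b then 1 else 0)) ℤ.- + count D
      moved-weight-∈ u D D' {b} u≈ u'≈ uL≡true DL≡b =
        symdiff-weight-complement (if b then 1 else 0) (moved-count u D D' u≈ u'≈ uL≡true)
                                  Π₀-count-∈ (count-decomposition-∈ D DL≡b)

    module _ (last∉Π₁ : inΠ₁ adj L ≡ false) where

      Π₀-coords-∉ : ∀ i → Π₀-coords i ≡ notLast i ∧ inΠ₁ adj i
      Π₀-coords-∉ i = cong (notLast i ∧_)
        (trans (cong (λ b → not (inΠ₁ adj i) xor not b) last∉Π₁)
               (trans (xor-comm (not (inΠ₁ adj i)) true) (not-involutive (inΠ₁ adj i))))

      Π₀-count-∉ : count Π₀-coords ≡ cardΠ₁ adj
      Π₀-count-∉ = count-cong λ i → trans (Π₀-coords-∉ i) (notLast-absorb (inΠ₁ adj) last∉Π₁ i)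

      overlap-∉ : ∀ D → count (λ i → D i ∧ Π₀-coords i) ≡ kOf adj D
      overlap-∉ D = count-cong λ i → cong (D i ∧_) (Π₀-coords-∉ i)

      moved-weight-∉ : ∀ u D D' → u ≈ sumOver D (Δ adj) → flipMat adj L · u ≈ sumOver D' (Δ adj) →
                       u L ≡ true → + count D' ≡ + count D ℤ.+ + cardΠ₁ adj ℤ.- + (2 * kOf adj D)
      moved-weight-∉ u D D' u≈ u'≈ uL≡true = begin
        + count D'
          ≡⟨ symdiff-weight {count D'} {count D} {count Π₀-coords} {count (λ i → D i ∧ Π₀-coords i)}
                            (moved-count u D D' u≈ u'≈ uL≡true) ⟩
        + count D ℤ.+ + count Π₀-coords ℤ.- + (2 * count (λ i → D i ∧ Π₀-coords i))
          ≡⟨ cong₂ (λ g h → + count D ℤ.+ + g ℤ.- + (2 * h)) Π₀-count-∉ (overlap-∉ D) ⟩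
        + count D ℤ.+ + cardΠ₁ adj ℤ.- + (2 * kOf adj D) ∎
        where open ≡-Reasoning

open Indicators using (isOdd; Even⇒¬isOdd; Odd⇒isOdd)
open import Data.Integer using (+_; _+_; _-_)
open import Data.Integer.Properties using (+-identityʳ)

lemma6p1 : (m : ℕ) (adj : Adj (suc (suc m))) → IsS m adj →
  Even (cardΠ₁ adj) →
  (u : F2^ (suc (suc m))) →
  -- (D encodes Δ(u), D' encodes Δ(𝐬ₙ u); sw = count)
  (InU adj u →
    ((D : Fin (suc (suc m)) → Bool) → u ≈ sumOver D (Δ adj) →
      (Even (kOf adj D) → flipMat adj lastV · u ≈ u)
      × (Odd (kOf adj D) → flipMat adj lastV · u ≈ u ⊕ sumΠ₀ adj))
    × ((D D' : Fin (suc (suc m)) → Bool) → u ≈ sumOver D (Δ adj) →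
        flipMat adj lastV · u ≈ sumOver D' (Δ adj) →
      (Even (kOf adj D) → count D' ≡ count D)
      × (Odd (kOf adj D) → inΠ₁ adj lastV ≡ true →
          + count D' ≡ + suc (suc m) - + cardΠ₁ adj + + (2 * kOf adj D) - + count D)
      × (Odd (kOf adj D) → inΠ₁ adj lastV ≡ false →
          + count D' ≡ + count D + + cardΠ₁ adj - + (2 * kOf adj D))))
  × (¬ InU adj u →
    ((D : Fin (suc (suc m)) → Bool) → u ≈ sumOver D (Δ adj) →
      (Odd (kOf adj D) → flipMat adj lastV · u ≈ u)
      × (Even (kOf adj D) → flipMat adj lastV · u ≈ u ⊕ sumΠ₀ adj))
    × ((D D' : Fin (suc (suc m)) → Bool) → u ≈ sumOver D (Δ adj) →
        flipMat adj lastV · u ≈ sumOver D' (Δ adj) →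
      (Odd (kOf adj D) → count D' ≡ count D)
      × (Even (kOf adj D) → inΠ₁ adj lastV ≡ true →
          + count D' ≡ + suc (suc m) - + cardΠ₁ adj + + (2 * kOf adj D) + + 2 - + count D)
      × (Even (kOf adj D) → inΠ₁ adj lastV ≡ false →
          + count D' ≡ + count D + + cardΠ₁ adj - + (2 * kOf adj D))))
lemma6p1 m adj S Π₁-even u =
    (λ u∈U → (λ D u≈ → flip-fixes u ∘ uL-U-even u∈U D u≈ , flip-adds-Π₀ u ∘ uL-U-odd u∈U D u≈)
           , (λ D D' u≈ u'≈ →
                fixed-weight u D D' u≈ u'≈ ∘ uL-U-even u∈U D u≈
              , (λ k-odd ∈ →
                   trans (moved-weight-∈ Π₁-even ∈ u D D' u≈ u'≈ (uL-U-odd u∈U D u≈ k-odd) (DL-U u∈U D u≈))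
                         (cong (_- + count D) (+-identityʳ (+ suc (suc m) - + cardΠ₁ adj + + (2 * kOf adj D)))))
              , (λ k-odd ∉ → moved-weight-∉ Π₁-even ∉ u D D' u≈ u'≈ (uL-U-odd u∈U D u≈ k-odd))))
  , (λ u∉U → (λ D u≈ → flip-fixes u ∘ uL-¬U-odd u∉U D u≈ , flip-adds-Π₀ u ∘ uL-¬U-even u∉U D u≈)
           , (λ D D' u≈ u'≈ →
                fixed-weight u D D' u≈ u'≈ ∘ uL-¬U-odd u∉U D u≈
              , (λ k-even ∈ →
                   moved-weight-∈ Π₁-even ∈ u D D' u≈ u'≈ (uL-¬U-even u∉U D u≈ k-even) (DL-¬U u∉U D u≈))
              , (λ k-even ∉ → moved-weight-∉ Π₁-even ∉ u D D' u≈ u'≈ (uL-¬U-even u∉U D u≈ k-even))))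
  where
  open PathGraph m adj S

  DL-U : InU adj u → ∀ D → u ≈ sumOver D (Δ adj) → D L ≡ false
  DL-U u∈U D u≈ = InU⇒last-coord-false Π₁-even u D u≈ u∈U

  DL-¬U : ¬ InU adj u → ∀ D → u ≈ sumOver D (Δ adj) → D L ≡ true
  DL-¬U u∉U D u≈ = ¬InU⇒last-coord-true u D u≈ u∉U

  uL≡ : ∀ D {p b} → u ≈ sumOver D (Δ adj) → isOdd (kOf adj D) ≡ p → D L ≡ b → u L ≡ p xor b
  uL≡ D u≈ refl refl = last-coord u D u≈

  uL-U-even : InU adj u → ∀ D → u ≈ sumOver D (Δ adj) → Even (kOf adj D) → u L ≡ false
  uL-U-even u∈U D u≈ k-even = uL≡ D u≈ (Even⇒¬isOdd (kOf adj D) k-even) (DL-U u∈U D u≈)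

  uL-U-odd : InU adj u → ∀ D → u ≈ sumOver D (Δ adj) → Odd (kOf adj D) → u L ≡ true
  uL-U-odd u∈U D u≈ k-odd = uL≡ D u≈ (Odd⇒isOdd (kOf adj D) k-odd) (DL-U u∈U D u≈)

  uL-¬U-even : ¬ InU adj u → ∀ D → u ≈ sumOver D (Δ adj) → Even (kOf adj D) → u L ≡ true
  uL-¬U-even u∉U D u≈ k-even = uL≡ D u≈ (Even⇒¬isOdd (kOf adj D) k-even) (DL-¬U u∉U D u≈)

  uL-¬U-odd : ¬ InU adj u → ∀ D → u ≈ sumOver D (Δ adj) → Odd (kOf adj D) → u L ≡ false
  uL-¬U-odd u∉U D u≈ k-odd = uL≡ D u≈ (Odd⇒isOdd (kOf adj D) k-odd) (DL-¬U u∉U D u≈)
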